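{- An edge $e=(u,v)$ of an edge-labeled phylogenetic tree $(T,\lambda)$ is irrelevant if and only if $e$ is an inner edge and every path from $v$ to each leaf in the subtree rooted at $v$ contains a 1-edge.
   Context: Phylogenetic tree: rooted tree, root degree $\ge2$, other inner vertices degree $\ge3$; edges $(u,v)$ with $u$ the parent of $v$; inner edges join two inner vertices. $\lambda:E\to\{0,1\}$, 1-edges/0-edges. $\mathcal{X}_{(T,\lambda)}$: $(x,y)$ for distinct leaves with a 1-edge on the path from $\operatorname{lca}(x,y)$ to $y$. An edge $e$ is irrelevant in $(T,\lambda)$ if the labeling $\lambda'$ with $\lambda'(e)\neq\lambda(e)$ and $\lambda'(f)=\lambda(f)$ for all $f\neq e$ satisfies $\mathcal{X}_{(T,\lambda')}=\mathcal{X}_{(T,\lambda)}$; otherwise $e$ is relevant. -}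

module Defs where

open import Data.Nat using (ℕ; suc)
open import Data.Fin using (Fin)
import Data.Fin as Fin
open import Data.Bool using (Bool; true)
open import Data.Unit using (⊤)
open import Data.Empty using (⊥)
open import Data.Product using (Σ; _×_)
open import Relation.Nullary using (¬_; yes; no)
open import Relation.Binary.PropositionalEquality using (_≡_; _≢_; refl)
open import Function.Bundles using (_⇔_)

-- Every inner vertex has at least
-- two children: this is exactly "root degree ≥ 2, other inner vertices
-- degree ≥ 3".
data Tree : Set where
  leaf : Tree
  node : (n : ℕ) → (Fin (suc (suc n)) → Tree) → Tree

-- Vertices of a tree, as positions (paths from the root).
data Vert : Tree → Set where
  root : ∀ {t} → Vert t
  sub  : ∀ {n ch} (i : Fin (suc (suc n))) → Vert (ch i) → Vert (node n ch)

subtreeAt : ∀ {t} → Vert t → Tree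
subtreeAt {t} root = t
subtreeAt (sub i v) = subtreeAt v

IsLeafTree : Tree → Set
IsLeafTree leaf = ⊤
IsLeafTree (node _ _) = ⊥

IsLeaf : ∀ {t} → Vert t → Set
IsLeaf v = IsLeafTree (subtreeAt v)

IsInner : ∀ {t} → Vert t → Set
IsInner v = ¬ IsLeaf v

data _≼_ : ∀ {t} → Vert t → Vert t → Set where
  root≼ : ∀ {t} {w : Vert t} → root ≼ w
  sub≼  : ∀ {n ch} {i : Fin (suc (suc n))} {u w : Vert (ch i)} →
          u ≼ w → sub {n} {ch} i u ≼ sub i w

-- Edges (u,v), u the parent of v.  'top i' is the edge from the root to
-- its i-th child; 'down i e' is the edge e inside the i-th child subtree.
data Edge : Tree → Set where
  top  : ∀ {n ch} (i : Fin (suc (suc n))) → Edge (node n ch)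
  down : ∀ {n ch} (i : Fin (suc (suc n))) → Edge (ch i) → Edge (node n ch)

parent : ∀ {t} → Edge t → Vert t
parent (top i) = root
parent (down i e) = sub i (parent e)

child : ∀ {t} → Edge t → Vert t
child (top i) = sub i root
child (down i e) = sub i (child e)

InnerEdge : ∀ {t} → Edge t → Set
InnerEdge e = IsInner (parent e) × IsInner (child e)

OnPath : ∀ {t} → Vert t → Vert t → Edge t → Set
OnPath u w f = (u ≼ parent f) × (child f ≼ w)

lca : ∀ {t} → Vert t → Vert t → Vert t
lca root _ = root
lca (sub i p) root = root
lca (sub i p) (sub j q) with i Fin.≟ j
... | yes refl = sub i (lca p q)
... | no _ = root

-- Edge labelings λ : E → {0,1}, with 1 = true.
Labeling : Tree → Set
Labeling t = Edge t → Bool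

𝒳 : ∀ {t} → Labeling t → Vert t → Vert t → Set
𝒳 {t} lab x y =
  IsLeaf x × IsLeaf y × x ≢ y ×
  Σ (Edge t) (λ f → OnPath (lca x y) y f × lab f ≡ true)

-- e is irrelevant: the labeling λ' differing from λ exactly at e yields the
-- same set 𝒳.  (λ' is determined pointwise; we quantify over all such λ'.)
Irrelevant : ∀ {t} → Labeling t → Edge t → Set
Irrelevant {t} lab e =
  (lab' : Labeling t) → lab' e ≢ lab e → (∀ f → f ≢ e → lab' f ≡ lab f) →
  ∀ x y → 𝒳 lab' x y ⇔ 𝒳 lab x y

Relevant : ∀ {t} → Labeling t → Edge t → Set
Relevant lab e = ¬ Irrelevant lab e

module Submission where

-- Sufficiency.  Let λ' differ from λ only at e.  A pair (x,y) is in 𝒳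
-- through some 1-edge f on lca(x,y) → y.  If f ≠ e the same edge works
-- for the other labeling; if f = e then y lies below v, and the 1-edge
-- shielding the path v → y lies strictly below e, so λ and λ' agree on it.
--
-- Necessity.  Given a leaf y below v, the parent u has a second child,
-- hence a leaf x outside the subtree of v with lca(x,y) = u.  Setting e
-- to 1 puts (x,y) into 𝒳; by irrelevance (x,y) stays in 𝒳 when e is set
-- to 0, and the 1-edge witnessing this is an edge ≠ e on u → y, i.e. an
-- edge on v → y.  Finally v is inner, since a leaf v would need a 1-edge
-- on the empty path v → v, and u is inner because it has children.

open import Defs
open import Data.Bool using (Bool; true; false)
import Data.Bool as Bool
open import Data.Nat using (suc)
open import Data.Fin using (Fin; zero; suc)
import Data.Fin as Fin
open import Data.Unit using (tt)
open import Data.Empty using (⊥-elim)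
open import Data.Product using (Σ; _×_; _,_; proj₁; proj₂)
open import Relation.Nullary using (¬_; Dec; yes; no)
open import Relation.Binary.PropositionalEquality
  using (_≡_; _≢_; refl; sym; trans; subst; cong)
open import Function.Bundles using (_⇔_; mk⇔; Equivalence)

≼-refl : ∀ {t} (v : Vert t) → v ≼ v
≼-refl root = root≼
≼-refl (sub i v) = sub≼ (≼-refl v)

≼-trans : ∀ {t} {u v w : Vert t} → u ≼ v → v ≼ w → u ≼ w
≼-trans root≼ _ = root≼
≼-trans (sub≼ p) (sub≼ q) = sub≼ (≼-trans p q)

parent≼child : ∀ {t} (e : Edge t) → parent e ≼ child e
parent≼child (top i) = root≼
parent≼child (down i e) = sub≼ (parent≼child e)

child⋠parent : ∀ {t} (e : Edge t) → ¬ (child e ≼ parent e)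
child⋠parent (top i) ()
child⋠parent (down i e) (sub≼ p) = child⋠parent e p

parent-inner : ∀ {t} (e : Edge t) → IsInner (parent e)
parent-inner (top i) ()
parent-inner (down i e) = parent-inner e

_≟E_ : ∀ {t} (e f : Edge t) → Dec (e ≡ f)
top i ≟E top j with i Fin.≟ j
... | yes refl = yes refl
... | no i≢j = no λ { refl → i≢j refl }
top i ≟E down j f = no λ ()
down i e ≟E top j = no λ ()
down i e ≟E down j f with i Fin.≟ j
... | no i≢j = no λ { refl → i≢j refl }
... | yes refl with e ≟E f
...   | yes refl = yes refl
...   | no e≢f = no λ { refl → e≢f refl }

below-child : ∀ {t} (e f : Edge t) {y : Vert t} → parent e ≼ parent f →
  child f ≼ y → child e ≼ y → f ≢ e → child e ≼ parent f
below-child (top i) (top .i) _ (sub≼ _) (sub≼ _) f≢e = ⊥-elim (f≢e refl)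
below-child (top i) (down .i f) _ (sub≼ _) (sub≼ _) _ = sub≼ root≼
below-child (down i e) (top j) () _ _ _
below-child (down i e) (down .i f) (sub≼ p) (sub≼ q) (sub≼ r) f≢e =
  sub≼ (below-child e f p q r λ { refl → f≢e refl })

someLeaf : (t : Tree) → Σ (Vert t) IsLeaf
someLeaf leaf = root , tt
someLeaf (node n ch) = sub zero (proj₁ (someLeaf (ch zero))) , proj₂ (someLeaf (ch zero))

anotherChild : ∀ {n} (i : Fin (suc (suc n))) → Σ (Fin (suc (suc n))) (λ j → j ≢ i)
anotherChild zero = suc zero , λ ()
anotherChild (suc i) = zero , λ ()

lca-distinct : ∀ {n ch} (i j : Fin (suc (suc n))) → j ≢ i →
  (a : Vert (ch j)) (b : Vert (ch i)) → lca {node n ch} (sub j a) (sub i b) ≡ root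
lca-distinct i j j≢i a b with j Fin.≟ i
... | yes refl = ⊥-elim (j≢i refl)
... | no _ = refl

lca-same : ∀ {n ch} (i : Fin (suc (suc n))) (a b : Vert (ch i)) →
  lca {node n ch} (sub i a) (sub i b) ≡ sub i (lca a b)
lca-same i a b with i Fin.≟ i
... | yes refl = refl
... | no i≢i = ⊥-elim (i≢i refl)

sub⋠sub : ∀ {n ch} (i j : Fin (suc (suc n))) → j ≢ i →
  {u : Vert (ch i)} {w : Vert (ch j)} → ¬ (sub {n} {ch} i u ≼ sub j w)
sub⋠sub i .i j≢i (sub≼ _) = j≢i refl

record SeparatedLeaf {t} (e : Edge t) (y : Vert t) : Set where
  constructor separated
  field
    x        : Vert t
    isLeaf   : IsLeaf x
    lca≡     : lca x y ≡ parent e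
    notBelow : ¬ (child e ≼ x)

-- Such a leaf exists for every y below child e: take a leaf under a
-- sibling of child e.
separatedLeaf : ∀ {t} (e : Edge t) {y : Vert t} → child e ≼ y → SeparatedLeaf e y
separatedLeaf {node n ch} (top i) {sub .i y} (sub≼ _) =
  let (j , j≢i) = anotherChild i ; (x , leaf-x) = someLeaf (ch j) in
  separated (sub j x) leaf-x (lca-distinct i j j≢i x y) (sub⋠sub i j j≢i)
separatedLeaf (down i e) {sub .i y} (sub≼ p) with separatedLeaf e p
... | separated x leaf-x eq nb =
  separated (sub i x) leaf-x (trans (lca-same i x y) (cong (sub i) eq))
            λ { (sub≼ q) → nb q }

AgreeOff : ∀ {t} → Edge t → Labeling t → Labeling t → Set
AgreeOff {t} e lab lab' = (f : Edge t) → f ≢ e → lab' f ≡ lab f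

setAt : ∀ {t} → Labeling t → Edge t → Bool → Labeling t
setAt lab e b f with f ≟E e
... | yes _ = b
... | no _ = lab f

setAt-here : ∀ {t} (lab : Labeling t) (e : Edge t) b → setAt lab e b e ≡ b
setAt-here lab e b with e ≟E e
... | yes _ = refl
... | no e≢e = ⊥-elim (e≢e refl)

setAt-elsewhere : ∀ {t} (lab : Labeling t) (e : Edge t) b → AgreeOff e lab (setAt lab e b)
setAt-elsewhere lab e b f f≢e with f ≟E e
... | yes f≡e = ⊥-elim (f≢e f≡e)
... | no _ = refl

𝒳-resp : ∀ {t} {lab lab' : Labeling t} → (∀ f → lab f ≡ lab' f) →
  ∀ {x y} → 𝒳 lab x y → 𝒳 lab' x y
𝒳-resp eq (lx , ly , x≢y , f , onPath , lf) = lx , ly , x≢y , f , onPath , trans (sym (eq f)) lf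

OneOnPath : ∀ {t} → Labeling t → Vert t → Vert t → Set
OneOnPath {t} lab u y = Σ (Edge t) (λ f → OnPath u y f × lab f ≡ true)

Shielded : ∀ {t} → Labeling t → Vert t → Set
Shielded {t} lab v = (y : Vert t) → IsLeaf y → v ≼ y → OneOnPath lab v y

-- The shielding edges of child e lie below e, so relabelling e keeps them.
shielded-agreeOff : ∀ {t} {lab lab' : Labeling t} (e : Edge t) → AgreeOff e lab lab' →
  Shielded lab (child e) → Shielded lab' (child e)
shielded-agreeOff e agree s y ly below with s y ly below
... | f , (p , q) , lf = f , (p , q) , trans (agree f λ { refl → child⋠parent e p }) lf

-- A leaf cannot be shielded: the path from it to itself has no edges.
shielded⇒inner : ∀ {t} {lab : Labeling t} (v : Vert t) → Shielded lab v → IsInner v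
shielded⇒inner v s leaf-v with s v leaf-v (≼-refl v)
... | f , (p , q) , _ = child⋠parent f (≼-trans q p)

transfer : ∀ {t} {lab₁ lab₂ : Labeling t} (e : Edge t) → AgreeOff e lab₁ lab₂ →
  Shielded lab₂ (child e) → ∀ {x y} → 𝒳 lab₁ x y → 𝒳 lab₂ x y
transfer e agree s (lx , ly , x≢y , f , (p , q) , lf) with f ≟E e
... | no f≢e = lx , ly , x≢y , f , (p , q) , trans (agree f f≢e) lf
... | yes refl with s _ ly q
...   | f' , (p' , q') , lf' =
  lx , ly , x≢y , f' , (≼-trans p (≼-trans (parent≼child e) p') , q') , lf'

shielded⇒irrelevant : ∀ {t} {lab : Labeling t} (e : Edge t) →
  Shielded lab (child e) → Irrelevant lab e
shielded⇒irrelevant e s lab' _ agree x y =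
  mk⇔ (transfer e (λ f f≢e → sym (agree f f≢e)) s)
      (transfer e agree (shielded-agreeOff e agree s))

irrelevant-setAt : ∀ {t} {lab : Labeling t} {e : Edge t} → Irrelevant lab e →
  ∀ b x y → 𝒳 (setAt lab e b) x y ⇔ 𝒳 lab x y
irrelevant-setAt {lab = lab} {e} irr b x y with b Bool.≟ lab e
... | no b≢lab-e = irr (setAt lab e b) (λ eq → b≢lab-e (trans (sym (setAt-here lab e b)) eq))
                       (setAt-elsewhere lab e b) x y
... | yes refl = mk⇔ (𝒳-resp unchanged) (𝒳-resp (λ f → sym (unchanged f)))
  where
  unchanged : ∀ f → setAt lab e (lab e) f ≡ lab f
  unchanged f with f ≟E e
  ... | yes refl = refl
  ... | no _ = refl

-- Set e to 1 to put (x,y) into 𝒳, then to 0; the surviving 1-edge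
-- shields the path from child e to y.
irrelevant⇒shielded : ∀ {t} {lab : Labeling t} (e : Edge t) →
  Irrelevant lab e → Shielded lab (child e)
irrelevant⇒shielded {lab = lab} e irr y ly below with separatedLeaf e below
... | separated x lx lca≡ x-outside
  with Equivalence.from (irrelevant-setAt irr false x y)
         (Equivalence.to (irrelevant-setAt irr true x y) via-e)
  where
  -- With e labelled 1, (x,y) ∈ 𝒳 because e lies on lca(x,y) → y.
  via-e : 𝒳 (setAt lab e true) x y
  via-e = lx , ly , (λ { refl → x-outside below }) , e ,
          (subst (_≼ parent e) (sym lca≡) (≼-refl _) , below) , setAt-here lab e true
...   | _ , _ , _ , f , (p , q) , lf =
  f , (below-child e f (subst (_≼ parent f) lca≡ p) q below f≢e , q) ,
  trans (sym (setAt-elsewhere lab e false f f≢e)) lf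
  where
  f≢e : f ≢ e
  f≢e refl with trans (sym (setAt-here lab e false)) lf
  ... | ()

lemma6 : (T : Tree) (lab : Labeling T) (e : Edge T) →
    Irrelevant lab e ⇔
      (InnerEdge e ×
       ((y : Vert T) → IsLeaf y → child e ≼ y →
         Σ (Edge T) (λ f → OnPath (child e) y f × lab f ≡ true)))
lemma6 T lab e = mk⇔ necessary (λ (_ , s) → shielded⇒irrelevant e s)
  where
  necessary : Irrelevant lab e → InnerEdge e × Shielded lab (child e)
  necessary irr =
    let s = irrelevant⇒shielded e irr in
    (parent-inner e , shielded⇒inner (child e) s) , s
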